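{- If $G$ is any well-tempered scoring game, then there exist games $G^+,G^-\in\mathcal{I}$ with $G^+\approx_+G\approx_-G^-$. If $S\subseteq\mathbb{Z}$ and $G$ is $S$-valued, then $G^+$ and $G^-$ can be chosen to be $S$-valued. Additionally, $G^+\gtrsim G^-$.
   Context: A well-tempered scoring game is defined recursively: an even-tempered game is either an integer or a pair $\{G^L|G^R\}$ with finite nonempty sets of odd-tempered left and right options; an odd-tempered game is a pair $\{G^L|G^R\}$ with finite nonempty sets of even-tempered options. Integers have no options. $\pi(G)=0$ for even-tempered, $1$ for odd-tempered games. Subgames: $G$ and subgames of its options; $G$ is $S$-valued if every integer subgame of $G$ lies in $S$. Outcomes: $\operatorname{L}(n)=\operatorname{R}(n)=n$ for integers, otherwise $\operatorname{L}(G)=\max_{G^L}\operatorname{R}(G^L)$, $\operatorname{R}(G)=\min_{G^R}\operatorname{L}(G^R)$. Final outcomes: $\operatorname{Lf}(G)=\operatorname{L}(G)$, $\operatorname{Rf}(G)=\operatorname{R}(G)$ if $G$ is odd-tempered; $\operatorname{Lf}(G)=\operatorname{R}(G)$, $\operatorname{Rf}(G)=\operatorname{L}(G)$ if even-tempered. Disjunctive sum: integer sum if both are integers, else $G+H=\{G^L+H,G+H^L\mid G^R+H,G+H^R\}$. $G\gtrsim H$ iff $\operatorname{L}(G+X)\ge\operatorname{L}(H+X)$ and $\operatorname{R}(G+X)\ge\operatorname{R}(H+X)$ for all games $X$. $G\approx_+H$ iff $\pi(G)=\pi(H)$ and $\operatorname{Lf}(G+X)=\operatorname{Lf}(H+X)$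 for all $X$; $G\approx_-H$ iff $\pi(G)=\pi(H)$ and $\operatorname{Rf}(G+X)=\operatorname{Rf}(H+X)$ for all $X$. $\operatorname{gap}_0(G)$ is the supremum of $\operatorname{R}(K)-\operatorname{L}(K)$ over even-tempered subgames $K$ of $G$; $\mathcal{I}$ is the class of games with $\operatorname{gap}_0(G)=0$. -}

module Defs where

open import Data.Bool using (Bool; true; false; not)
open import Data.Integer using (ℤ; _+_; _-_; _⊔_; _⊓_; _≤_; _≥_; 0ℤ)
open import Data.Product using (_×_; _,_)
open import Relation.Binary.PropositionalEquality using (_≡_; refl; subst)

-- Parity (temper): false = even-tempered, true = odd-tempered.
-- A game of parity p is Game p; π(G) is its index.

mutual
  data Opts (p : Bool) : Set where
    [_] : Game p → Opts p
    _∷_ : Game p → Opts p → Opts p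

  data Game : Bool → Set where
    int  : ℤ → Game false
    node : {p : Bool} → Opts (not p) → Opts (not p) → Game p

infixr 5 _∷_

π : {p : Bool} → Game p → Bool
π {p} _ = p

_xor_ : Bool → Bool → Bool
false xor q = q
true  xor q = not q

not-xorˡ : (p q : Bool) → (not p xor q) ≡ not (p xor q)
not-xorˡ false false = refl
not-xorˡ false true  = refl
not-xorˡ true  false = refl
not-xorˡ true  true  = refl

not-xorʳ : (p q : Bool) → (p xor not q) ≡ not (p xor q)
not-xorʳ false false = refl
not-xorʳ false true  = refl
not-xorʳ true  false = refl
not-xorʳ true  true  = refl

_++ᴼ_ : {p : Bool} → Opts p → Opts p → Opts p
[ g ]    ++ᴼ ys = g ∷ ys
(g ∷ xs) ++ᴼ ys = g ∷ (xs ++ᴼ ys)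

mutual
  infixl 6 _⊕_
  _⊕_ : {p q : Bool} → Game p → Game q → Game (p xor q)
  int m ⊕ int n = int (m + n)
  int m ⊕ node l r = node (addR (int m) l) (addR (int m) r)
  node l r ⊕ int n = node (addL l (int n)) (addL r (int n))
  node l r ⊕ node l′ r′ =
    node (addL l (node l′ r′) ++ᴼ addR (node l r) l′)
         (addL r (node l′ r′) ++ᴼ addR (node l r) r′)

  addL : {p q : Bool} → Opts (not p) → Game q → Opts (not (p xor q))
  addL {p} {q} [ g ] H = [ subst Game (not-xorˡ p q) (g ⊕ H) ]
  addL {p} {q} (g ∷ os) H = subst Game (not-xorˡ p q) (g ⊕ H) ∷ addL os H

  addR : {p q : Bool} → Game p → Opts (not q) → Opts (not (p xor q))
  addR {p} {q} G [ h ] = [ subst Game (not-xorʳ p q) (G ⊕ h) ]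
  addR {p} {q} G (h ∷ os) = subst Game (not-xorʳ p q) (G ⊕ h) ∷ addR G os

mutual
  Lo : {p : Bool} → Game p → ℤ
  Lo (int n) = n
  Lo (node l r) = maxR l

  Ro : {p : Bool} → Game p → ℤ
  Ro (int n) = n
  Ro (node l r) = minL r

  maxR : {p : Bool} → Opts p → ℤ
  maxR [ g ] = Ro g
  maxR (g ∷ os) = Ro g ⊔ maxR os

  minL : {p : Bool} → Opts p → ℤ
  minL [ g ] = Lo g
  minL (g ∷ os) = Lo g ⊓ minL os

Lf : {p : Bool} → Game p → ℤ
Lf {true}  G = Lo G
Lf {false} G = Ro G

Rf : {p : Bool} → Game p → ℤ
Rf {true}  G = Ro G
Rf {false} G = Lo G

data _∈ᴼ_ {p : Bool} : Game p → Opts p → Set where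
  here₁ : {g : Game p} → g ∈ᴼ [ g ]
  here  : {g : Game p} {os : Opts p} → g ∈ᴼ (g ∷ os)
  there : {g h : Game p} {os : Opts p} → g ∈ᴼ os → g ∈ᴼ (h ∷ os)

data Subgame {q : Bool} (K : Game q) : {p : Bool} → Game p → Set where
  self  : Subgame K K
  viaL  : {p : Bool} {l r : Opts (not p)} {g : Game (not p)} →
          g ∈ᴼ l → Subgame K g → Subgame K (node {p} l r)
  viaR  : {p : Bool} {l r : Opts (not p)} {g : Game (not p)} →
          g ∈ᴼ r → Subgame K g → Subgame K (node {p} l r)

SValued : (S : ℤ → Set) → {p : Bool} → Game p → Set
SValued S G = (n : ℤ) → Subgame (int n) G → S n

IsGap₀ : {p : Bool} → Game p → ℤ → Set
IsGap₀ G g =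
  ((K : Game false) → Subgame K G → Ro K - Lo K ≤ g) ×
  ((b : ℤ) → ((K : Game false) → Subgame K G → Ro K - Lo K ≤ b) → g ≤ b)

𝓘 : {p : Bool} → Game p → Set
𝓘 G = IsGap₀ G 0ℤ

_≳_ : {p q : Bool} → Game p → Game q → Set
G ≳ H = {r : Bool} (X : Game r) → (Lo (G ⊕ X) ≥ Lo (H ⊕ X)) × (Ro (G ⊕ X) ≥ Ro (H ⊕ X))

_≈₊_ : {p q : Bool} → Game p → Game q → Set
_≈₊_ {p} {q} G H = (p ≡ q) × ({r : Bool} (X : Game r) → Lf (G ⊕ X) ≡ Lf (H ⊕ X))

_≈₋_ : {p q : Bool} → Game p → Game q → Set
_≈₋_ {p} {q} G H = (p ≡ q) × ({r : Bool} (X : Game r) → Rf (G ⊕ X) ≡ Rf (H ⊕ X))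

-- G⁺ rebuilds G from the leaves up, replacing every even-tempered subgame H with L(H) < R(H)
-- (a zugzwang) by the integer R(H); G⁻ uses L(H) instead.  Once the options of such an H are
-- zugzwang-free, H + X has Left-final outcome R(H) + Lf(X) and Right-final outcome L(H) + Rf(X)
-- for every X: one inequality is superadditivity of Lf (subadditivity of Rf) on sums that are not
-- both odd-tempered, the other comes from the bounds Lf(A + X) ≤ Rf(A) + Lf(X) and
-- Lf(A) + Rf(X) ≤ Rf(A + X) for zugzwang-free A.  Hence R(H) ≈₊ H ≈₋ L(H) and R(H) ≳ H ≳ L(H),
-- and since these relations survive building a game from related options, they pass up to G.
-- The new integers are outcomes of H, hence values of integer subgames, so S-valuedness is kept.
module Submission where

open import Defs
open import Data.Bool using (Bool; true; false; not; _∧_)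
open import Data.Integer using (ℤ; _+_; _≤_; _<_)
import Data.Integer.Properties as ℤ
open import Data.Product using (Σ; Σ-syntax; _×_; _,_; proj₁; proj₂)
open import Data.Empty using (⊥-elim)
open import Data.Sum using (_⊎_; inj₁; inj₂)
open import Function using (flip)
open import Relation.Binary.PropositionalEquality using (_≡_; refl; sym; trans; cong; subst)
open import Relation.Nullary using (Dec; yes; no)

open ℤ.≤-Reasoning

private variable
  p q : Bool

maxR-≥ : {os : Opts p} {g : Game p} → g ∈ᴼ os → Ro g ≤ maxR os
maxR-≥ here₁ = ℤ.≤-refl
maxR-≥ {os = g ∷ os} here = ℤ.i≤i⊔j (Ro g) (maxR os)
maxR-≥ {os = h ∷ os} (there m) = ℤ.i≤j⇒i≤k⊔j (Ro h) (maxR-≥ m)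

maxR-lub : {os : Opts p} {b : ℤ} → (∀ {g} → g ∈ᴼ os → Ro g ≤ b) → maxR os ≤ b
maxR-lub {os = [ g ]} f = f here₁
maxR-lub {os = g ∷ os} f = ℤ.⊔-lub (f here) (maxR-lub (λ m → f (there m)))

minL-≤ : {os : Opts p} {g : Game p} → g ∈ᴼ os → minL os ≤ Lo g
minL-≤ here₁ = ℤ.≤-refl
minL-≤ {os = g ∷ os} here = ℤ.i⊓j≤i (Lo g) (minL os)
minL-≤ {os = h ∷ os} (there m) = ℤ.i≤j⇒k⊓i≤j (Lo h) (minL-≤ m)

minL-glb : {os : Opts p} {b : ℤ} → (∀ {g} → g ∈ᴼ os → b ≤ Lo g) → b ≤ minL os
minL-glb {os = [ g ]} f = f here₁
minL-glb {os = g ∷ os} f = ℤ.⊓-glb (f here) (minL-glb (λ m → f (there m)))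

maxR-attained : (os : Opts p) → Σ[ g ∈ Game p ] g ∈ᴼ os × Ro g ≡ maxR os
maxR-attained [ g ] = g , here₁ , refl
maxR-attained (g ∷ os) with ℤ.≤-total (Ro g) (maxR os)
... | inj₁ g≤os = let (h , m , e) = maxR-attained os in
  h , there m , trans e (sym (ℤ.i≤j⇒i⊔j≡j g≤os))
... | inj₂ os≤g = g , here , sym (ℤ.i≥j⇒i⊔j≡i os≤g)

minL-attained : (os : Opts p) → Σ[ g ∈ Game p ] g ∈ᴼ os × Lo g ≡ minL os
minL-attained [ g ] = g , here₁ , refl
minL-attained (g ∷ os) with ℤ.≤-total (Lo g) (minL os)
... | inj₁ g≤os = g , here , sym (ℤ.i≤j⇒i⊓j≡i g≤os)
... | inj₂ os≤g = let (h , m , e) = minL-attained os in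
  h , there m , trans e (sym (ℤ.i≥j⇒i⊓j≡j os≤g))

∈-++⁺ˡ : {xs ys : Opts p} {x : Game p} → x ∈ᴼ xs → x ∈ᴼ (xs ++ᴼ ys)
∈-++⁺ˡ here₁ = here
∈-++⁺ˡ here = here
∈-++⁺ˡ (there m) = there (∈-++⁺ˡ m)

∈-++⁺ʳ : (xs : Opts p) {ys : Opts p} {x : Game p} → x ∈ᴼ ys → x ∈ᴼ (xs ++ᴼ ys)
∈-++⁺ʳ [ g ] m = there m
∈-++⁺ʳ (g ∷ xs) m = there (∈-++⁺ʳ xs m)

∈-++⁻ : (xs : Opts p) {ys : Opts p} {x : Game p} →
  x ∈ᴼ (xs ++ᴼ ys) → x ∈ᴼ xs ⊎ x ∈ᴼ ys
∈-++⁻ [ g ] here = inj₁ here₁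
∈-++⁻ [ g ] (there m) = inj₂ m
∈-++⁻ (g ∷ xs) here = inj₁ here
∈-++⁻ (g ∷ xs) (there m) with ∈-++⁻ xs m
... | inj₁ m′ = inj₁ (there m′)
... | inj₂ m′ = inj₂ m′

data LOpt {p : Bool} : Game (not p) → Game p → Set where
  lopt : {l r : Opts (not p)} {g : Game (not p)} → g ∈ᴼ l → LOpt g (node l r)

data ROpt {p : Bool} : Game (not p) → Game p → Set where
  ropt : {l r : Opts (not p)} {g : Game (not p)} → g ∈ᴼ r → ROpt g (node l r)

Lo-≥ : {G : Game p} {g : Game (not p)} → LOpt g G → Ro g ≤ Lo G
Lo-≥ (lopt m) = maxR-≥ m

Ro-≤ : {G : Game p} {g : Game (not p)} → ROpt g G → Ro G ≤ Lo g
Ro-≤ (ropt m) = minL-≤ m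

GameStep : ({p : Bool} → Game p → Set) → Set
GameStep P = {p : Bool} (G : Game p) →
  (∀ {g} → LOpt g G → P g) → (∀ {g} → ROpt g G → P g) → P G

module _ (P : {p : Bool} → Game p → Set) (step : GameStep P) where
  mutual
    gameInd : (G : Game p) → P G
    gameInd (int n) = step (int n) (λ ()) (λ ())
    gameInd (node l r) =
      step (node l r) (λ { (lopt m) → optsInd l m }) (λ { (ropt m) → optsInd r m })

    optsInd : (os : Opts p) {g : Game p} → g ∈ᴼ os → P g
    optsInd [ g ] here₁ = gameInd g
    optsInd (g ∷ os) here = gameInd g
    optsInd (g ∷ os) (there m) = optsInd os m

PairStep : ({p q : Bool} → Game p → Game q → Set) → Set
PairStep P = {p q : Bool} (A : Game p) (X : Game q) →
  (∀ {g} → LOpt g A → P g X) → (∀ {g} → ROpt g A → P g X) →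
  (∀ {h} → LOpt h X → P A h) → (∀ {h} → ROpt h X → P A h) → P A X

pairInd : (P : {p q : Bool} → Game p → Game q → Set) → PairStep P →
  (A : Game p) (X : Game q) → P A X
pairInd P step A X = gameInd (λ B → ∀ {q} (Y : Game q) → P B Y)
  (λ B ihl ihr → gameInd (P B) (λ Y → step B Y (λ o → ihl o Y) (λ o → ihr o Y))) A X

-- Equal outcomes: lets the options of a sum be handled without the parity casts in addL/addR.
infix 4 _≐_
_≐_ : {p q : Bool} → Game p → Game q → Set
x ≐ y = Lo x ≡ Lo y × Ro x ≡ Ro y

subst-≐ : {p′ : Bool} (e : p ≡ p′) (x : Game p) → subst Game e x ≐ x
subst-≐ refl x = refl , refl

∈-addL⁺ : {l : Opts (not p)} {g : Game (not p)} (H : Game q) → g ∈ᴼ l →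
  Σ[ x ∈ Game (not (p xor q)) ] x ∈ᴼ addL {p} l H × x ≐ g ⊕ H
∈-addL⁺ {p} {q} {g = g} H here₁ = _ , here₁ , subst-≐ (not-xorˡ p q) (g ⊕ H)
∈-addL⁺ {p} {q} {g = g} H here = _ , here , subst-≐ (not-xorˡ p q) (g ⊕ H)
∈-addL⁺ H (there m) = let (x , m′ , e) = ∈-addL⁺ H m in x , there m′ , e

∈-addL⁻ : (l : Opts (not p)) (H : Game q) {x : Game (not (p xor q))} → x ∈ᴼ addL {p} l H →
  Σ[ g ∈ Game (not p) ] g ∈ᴼ l × x ≐ g ⊕ H
∈-addL⁻ {p} {q} [ g ] H here₁ = g , here₁ , subst-≐ (not-xorˡ p q) (g ⊕ H)
∈-addL⁻ {p} {q} (g ∷ l) H here = g , here , subst-≐ (not-xorˡ p q) (g ⊕ H)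
∈-addL⁻ (g ∷ l) H (there m) = let (g′ , m′ , e) = ∈-addL⁻ l H m in g′ , there m′ , e

∈-addR⁺ : {p q : Bool} {l : Opts (not q)} {h : Game (not q)} (G : Game p) → h ∈ᴼ l →
  Σ[ x ∈ Game (not (p xor q)) ] x ∈ᴼ addR {p} {q} G l × x ≐ G ⊕ h
∈-addR⁺ {p} {q} {h = h} G here₁ = _ , here₁ , subst-≐ (not-xorʳ p q) (G ⊕ h)
∈-addR⁺ {p} {q} {h = h} G here = _ , here , subst-≐ (not-xorʳ p q) (G ⊕ h)
∈-addR⁺ G (there m) = let (x , m′ , e) = ∈-addR⁺ G m in x , there m′ , e

∈-addR⁻ : (G : Game p) (l : Opts (not q)) {x : Game (not (p xor q))} →
  x ∈ᴼ addR {p} {q} G l →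
  Σ[ h ∈ Game (not q) ] h ∈ᴼ l × x ≐ G ⊕ h
∈-addR⁻ {p} {q} G [ h ] here₁ = h , here₁ , subst-≐ (not-xorʳ p q) (G ⊕ h)
∈-addR⁻ {p} {q} G (h ∷ l) here = h , here , subst-≐ (not-xorʳ p q) (G ⊕ h)
∈-addR⁻ G (h ∷ l) (there m) = let (h′ , m′ , e) = ∈-addR⁻ G l m in h′ , there m′ , e

Lo-⊕-≥ˡ : {A : Game p} {X : Game q} {g : Game (not p)} →
  LOpt g A → Ro (g ⊕ X) ≤ Lo (A ⊕ X)
Lo-⊕-≥ˡ {p} {X = int n} (lopt m) =
  let (_ , m′ , e) = ∈-addL⁺ {p} (int n) m in subst (_≤ _) (proj₂ e) (maxR-≥ m′)
Lo-⊕-≥ˡ {p} {X = node l′ r′} (lopt m) =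
  let (_ , m′ , e) = ∈-addL⁺ {p} (node l′ r′) m in
  subst (_≤ _) (proj₂ e) (maxR-≥ (∈-++⁺ˡ m′))

Lo-⊕-≥ʳ : {A : Game p} {X : Game q} {h : Game (not q)} →
  LOpt h X → Ro (A ⊕ h) ≤ Lo (A ⊕ X)
Lo-⊕-≥ʳ {A = int n} (lopt m) =
  let (_ , m′ , e) = ∈-addR⁺ (int n) m in subst (_≤ _) (proj₂ e) (maxR-≥ m′)
Lo-⊕-≥ʳ {p} {A = node l r} {X = node _ r′} (lopt m) =
  let (_ , m′ , e) = ∈-addR⁺ (node l r) m in
  subst (_≤ _) (proj₂ e) (maxR-≥ (∈-++⁺ʳ (addL {p} l (node _ r′)) m′))

Ro-⊕-≤ˡ : {A : Game p} {X : Game q} {g : Game (not p)} →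
  ROpt g A → Ro (A ⊕ X) ≤ Lo (g ⊕ X)
Ro-⊕-≤ˡ {p} {X = int n} (ropt m) =
  let (_ , m′ , e) = ∈-addL⁺ {p} (int n) m in subst (_ ≤_) (proj₁ e) (minL-≤ m′)
Ro-⊕-≤ˡ {p} {X = node l′ r′} (ropt m) =
  let (_ , m′ , e) = ∈-addL⁺ {p} (node l′ r′) m in
  subst (_ ≤_) (proj₁ e) (minL-≤ (∈-++⁺ˡ m′))

Ro-⊕-≤ʳ : {A : Game p} {X : Game q} {h : Game (not q)} →
  ROpt h X → Ro (A ⊕ X) ≤ Lo (A ⊕ h)
Ro-⊕-≤ʳ {A = int n} (ropt m) =
  let (_ , m′ , e) = ∈-addR⁺ (int n) m in subst (_ ≤_) (proj₁ e) (minL-≤ m′)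
Ro-⊕-≤ʳ {p} {A = node l r} {X = node l′ _} (ropt m) =
  let (_ , m′ , e) = ∈-addR⁺ (node l r) m in
  subst (_ ≤_) (proj₁ e) (minL-≤ (∈-++⁺ʳ (addL {p} r (node l′ _)) m′))

data NotBothInt {p q : Bool} : Game p → Game q → Set where
  nodeˡ : {l r : Opts (not p)} {X : Game q} → NotBothInt (node l r) X
  nodeʳ : {A : Game p} {l r : Opts (not q)} → NotBothInt A (node l r)

Lo-⊕-lub : {A : Game p} {X : Game q} {b : ℤ} → NotBothInt A X →
  (∀ {g} → LOpt g A → Ro (g ⊕ X) ≤ b) → (∀ {h} → LOpt h X → Ro (A ⊕ h) ≤ b) →
  Lo (A ⊕ X) ≤ b
Lo-⊕-lub {A = int _} {X = int _} ()
Lo-⊕-lub {p} {A = node l r} {X = int n} _ fA _ = maxR-lub λ m →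
  let (g , m′ , e) = ∈-addL⁻ {p} l (int n) m in subst (_≤ _) (sym (proj₂ e)) (fA (lopt m′))
Lo-⊕-lub {A = int n} {X = node l′ r′} _ _ fX = maxR-lub λ m →
  let (h , m′ , e) = ∈-addR⁻ (int n) l′ m in subst (_≤ _) (sym (proj₂ e)) (fX (lopt m′))
Lo-⊕-lub {p} {A = node l r} {X = node l′ r′} _ fA fX = maxR-lub λ m →
  case (∈-++⁻ (addL {p} l (node l′ r′)) m)
  where
  case : ∀ {x} → x ∈ᴼ addL {p} l (node l′ r′) ⊎ x ∈ᴼ addR (node l r) l′ →
    Ro x ≤ _
  case (inj₁ m) = let (g , m′ , e) = ∈-addL⁻ {p} l (node l′ r′) m in
    subst (_≤ _) (sym (proj₂ e)) (fA (lopt m′))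
  case (inj₂ m) = let (h , m′ , e) = ∈-addR⁻ (node l r) l′ m in
    subst (_≤ _) (sym (proj₂ e)) (fX (lopt m′))

Ro-⊕-glb : {A : Game p} {X : Game q} {b : ℤ} → NotBothInt A X →
  (∀ {g} → ROpt g A → b ≤ Lo (g ⊕ X)) → (∀ {h} → ROpt h X → b ≤ Lo (A ⊕ h)) →
  b ≤ Ro (A ⊕ X)
Ro-⊕-glb {A = int _} {X = int _} ()
Ro-⊕-glb {p} {A = node l r} {X = int n} _ fA _ = minL-glb λ m →
  let (g , m′ , e) = ∈-addL⁻ {p} r (int n) m in subst (_ ≤_) (sym (proj₁ e)) (fA (ropt m′))
Ro-⊕-glb {A = int n} {X = node l′ r′} _ _ fX = minL-glb λ m →
  let (h , m′ , e) = ∈-addR⁻ (int n) r′ m in subst (_ ≤_) (sym (proj₁ e)) (fX (ropt m′))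
Ro-⊕-glb {p} {A = node l r} {X = node l′ r′} _ fA fX = minL-glb λ m →
  case (∈-++⁻ (addL {p} r (node l′ r′)) m)
  where
  case : ∀ {x} → x ∈ᴼ addL {p} r (node l′ r′) ⊎ x ∈ᴼ addR (node l r) r′ →
    _ ≤ Lo x
  case (inj₁ m) = let (g , m′ , e) = ∈-addL⁻ {p} r (node l′ r′) m in
    subst (_ ≤_) (sym (proj₁ e)) (fA (ropt m′))
  case (inj₂ m) = let (h , m′ , e) = ∈-addR⁻ (node l r) r′ m in
    subst (_ ≤_) (sym (proj₁ e)) (fX (ropt m′))

outcomes-⊕-int : (n : ℤ) (A : Game p) →
  Lo (A ⊕ int n) ≡ Lo A + n × Ro (A ⊕ int n) ≡ Ro A + n
outcomes-⊕-int n = gameInd Shifted step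
  where
  Shifted : {p : Bool} → Game p → Set
  Shifted A = Lo (A ⊕ int n) ≡ Lo A + n × Ro (A ⊕ int n) ≡ Ro A + n

  step : GameStep Shifted
  step (int m) _ _ = refl , refl
  step A@(node l r) ihl ihr =
    ℤ.≤-antisym
      (Lo-⊕-lub nodeˡ (λ {g} o → begin
        Ro (g ⊕ int n) ≡⟨ proj₂ (ihl o) ⟩
        Ro g + n       ≤⟨ ℤ.+-monoˡ-≤ n (Lo-≥ o) ⟩
        Lo A + n       ∎) (λ ()))
      (let (g , m , e) = maxR-attained l in begin
        Lo A + n       ≡⟨ cong (_+ n) (sym e) ⟩
        Ro g + n       ≡⟨ sym (proj₂ (ihl (lopt m))) ⟩
        Ro (g ⊕ int n) ≤⟨ Lo-⊕-≥ˡ {A = A} (lopt m) ⟩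
        Lo (A ⊕ int n) ∎)
    , ℤ.≤-antisym
      (let (g , m , e) = minL-attained r in begin
        Ro (A ⊕ int n) ≤⟨ Ro-⊕-≤ˡ {A = A} (ropt m) ⟩
        Lo (g ⊕ int n) ≡⟨ proj₁ (ihr (ropt m)) ⟩
        Lo g + n       ≡⟨ cong (_+ n) e ⟩
        Ro A + n       ∎)
      (Ro-⊕-glb nodeˡ (λ {g} o → begin
        Ro A + n       ≤⟨ ℤ.+-monoˡ-≤ n (Ro-≤ o) ⟩
        Lo g + n       ≡⟨ sym (proj₁ (ihr o)) ⟩
        Lo (g ⊕ int n) ∎) (λ ()))

outcomes-int-⊕ : (n : ℤ) (A : Game p) →
  Lo (int n ⊕ A) ≡ n + Lo A × Ro (int n ⊕ A) ≡ n + Ro A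
outcomes-int-⊕ n = gameInd Shifted step
  where
  Shifted : {p : Bool} → Game p → Set
  Shifted A = Lo (int n ⊕ A) ≡ n + Lo A × Ro (int n ⊕ A) ≡ n + Ro A

  step : GameStep Shifted
  step (int m) _ _ = refl , refl
  step A@(node l r) ihl ihr =
    ℤ.≤-antisym
      (Lo-⊕-lub {A = int n} nodeʳ (λ ()) (λ {h} o → begin
        Ro (int n ⊕ h) ≡⟨ proj₂ (ihl o) ⟩
        n + Ro h       ≤⟨ ℤ.+-monoʳ-≤ n (Lo-≥ o) ⟩
        n + Lo A       ∎))
      (let (h , m , e) = maxR-attained l in begin
        n + Lo A       ≡⟨ cong (n +_) (sym e) ⟩
        n + Ro h       ≡⟨ sym (proj₂ (ihl (lopt m))) ⟩
        Ro (int n ⊕ h) ≤⟨ Lo-⊕-≥ʳ {A = int n} {X = A} (lopt m) ⟩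
        Lo (int n ⊕ A) ∎)
    , ℤ.≤-antisym
      (let (h , m , e) = minL-attained r in begin
        Ro (int n ⊕ A) ≤⟨ Ro-⊕-≤ʳ {A = int n} {X = A} (ropt m) ⟩
        Lo (int n ⊕ h) ≡⟨ proj₁ (ihr (ropt m)) ⟩
        n + Lo h       ≡⟨ cong (n +_) e ⟩
        n + Ro A       ∎)
      (Ro-⊕-glb {A = int n} nodeʳ (λ ()) (λ {h} o → begin
        n + Ro A       ≤⟨ ℤ.+-monoʳ-≤ n (Ro-≤ o) ⟩
        n + Lo h       ≡⟨ sym (proj₁ (ihr o)) ⟩
        Lo (int n ⊕ h) ∎))

Lf-⊕-int : (n : ℤ) (A : Game p) → Lf (A ⊕ int n) ≡ Lf A + n
Lf-⊕-int {false} n A = proj₂ (outcomes-⊕-int n A)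
Lf-⊕-int {true} n A = proj₁ (outcomes-⊕-int n A)

Rf-⊕-int : (n : ℤ) (A : Game p) → Rf (A ⊕ int n) ≡ Rf A + n
Rf-⊕-int {false} n A = proj₁ (outcomes-⊕-int n A)
Rf-⊕-int {true} n A = proj₂ (outcomes-⊕-int n A)

Lf-int-⊕ : (n : ℤ) (A : Game p) → Lf (int n ⊕ A) ≡ n + Lf A
Lf-int-⊕ {false} n A = proj₂ (outcomes-int-⊕ n A)
Lf-int-⊕ {true} n A = proj₁ (outcomes-int-⊕ n A)

Rf-int-⊕ : (n : ℤ) (A : Game p) → Rf (int n ⊕ A) ≡ n + Rf A
Rf-int-⊕ {false} n A = proj₁ (outcomes-int-⊕ n A)
Rf-int-⊕ {true} n A = proj₂ (outcomes-int-⊕ n A)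

outcomes-realized : (G : Game p) → Subgame (int (Lo G)) G × Subgame (int (Ro G)) G
outcomes-realized = gameInd (λ G → Subgame (int (Lo G)) G × Subgame (int (Ro G)) G) step
  where
  step : GameStep (λ G → Subgame (int (Lo G)) G × Subgame (int (Ro G)) G)
  step (int n) _ _ = self , self
  step (node l r) ihl ihr =
      (let (g , m , e) = maxR-attained l in
       viaL m (subst (λ v → Subgame (int v) g) e (proj₂ (ihl (lopt m)))))
    , (let (g , m , e) = minL-attained r in
       viaR m (subst (λ v → Subgame (int v) g) e (proj₁ (ihr (ropt m)))))

IsZugzwang : Game false → Set
IsZugzwang H = Lo H < Ro H

ZugzwangFree : Game p → Set
ZugzwangFree G = (K : Game false) → Subgame K G → Ro K ≤ Lo K

OptionsZugzwangFree : Game p → Set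
OptionsZugzwangFree G =
  (∀ {g} → LOpt g G → ZugzwangFree g) × (∀ {g} → ROpt g G → ZugzwangFree g)

ZugzwangFree-options : {G : Game p} → ZugzwangFree G → OptionsZugzwangFree G
ZugzwangFree-options free =
  (λ { (lopt m) K sk → free K (viaL m sk) }) , (λ { (ropt m) K sk → free K (viaR m sk) })

ZugzwangFree-int : (n : ℤ) → ZugzwangFree (int n)
ZugzwangFree-int n _ self = ℤ.≤-refl

ZugzwangFree-node : {l r : Opts (not p)} → (p ≡ false → Ro (node l r) ≤ Lo (node l r)) →
  OptionsZugzwangFree (node l r) → ZugzwangFree (node l r)
ZugzwangFree-node even _ _ self = even refl
ZugzwangFree-node _ (freeˡ , _) K (viaL m sk) = freeˡ (lopt m) K sk
ZugzwangFree-node _ (_ , freeʳ) K (viaR m sk) = freeʳ (ropt m) K sk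

ZugzwangFree⇒𝓘 : (G : Game p) → ZugzwangFree G → 𝓘 G
ZugzwangFree⇒𝓘 G free =
    (λ K sk → ℤ.i≤j⇒i-j≤0 (free K sk))
  , (λ b bound → subst (_≤ b) (ℤ.+-inverseʳ (Lo G)) (bound _ (proj₁ (outcomes-realized G))))

Lf-superadditive : (A : Game p) (X : Game q) → p ∧ q ≡ false → Lf A + Lf X ≤ Lf (A ⊕ X)
Lf-superadditive = pairInd Super step
  where
  Super : {p q : Bool} → Game p → Game q → Set
  Super {p} {q} A X = p ∧ q ≡ false → Lf A + Lf X ≤ Lf (A ⊕ X)

  even : {A X : Game false} → NotBothInt A X →
    (∀ {g} → ROpt g A → Super g X) → (∀ {h} → ROpt h X → Super A h) →
    Ro A + Ro X ≤ Ro (A ⊕ X)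
  even {A} {X} nbi ihr ihr′ = Ro-⊕-glb nbi
    (λ {g} o → begin
      Ro A + Ro X ≤⟨ ℤ.+-monoˡ-≤ (Ro X) (Ro-≤ o) ⟩
      Lo g + Ro X ≤⟨ ihr o refl ⟩
      Lo (g ⊕ X)  ∎)
    (λ {h} o → begin
      Ro A + Ro X ≤⟨ ℤ.+-monoʳ-≤ (Ro A) (Ro-≤ o) ⟩
      Ro A + Lo h ≤⟨ ihr′ o refl ⟩
      Lo (A ⊕ h)  ∎)

  step : PairStep Super
  step {true} {true} _ _ _ _ _ _ ()
  step {false} {false} (int m) (int n) _ _ _ _ _ = ℤ.≤-refl
  step {false} {false} (node _ _) X _ ihr _ ihr′ _ = even nodeˡ ihr ihr′
  step {false} {false} A@(int _) (node _ _) _ ihr _ ihr′ _ = even {A = A} nodeʳ ihr ihr′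
  step {true} {false} A@(node l r) X ihl _ _ _ _ = let (g , m , e) = maxR-attained l in begin
    Lo A + Ro X ≡⟨ cong (_+ Ro X) (sym e) ⟩
    Ro g + Ro X ≤⟨ ihl (lopt m) refl ⟩
    Ro (g ⊕ X)  ≤⟨ Lo-⊕-≥ˡ {A = A} (lopt m) ⟩
    Lo (A ⊕ X)  ∎
  step {false} {true} A X@(node l r) _ _ ihl′ _ _ = let (h , m , e) = maxR-attained l in begin
    Ro A + Lo X ≡⟨ cong (Ro A +_) (sym e) ⟩
    Ro A + Ro h ≤⟨ ihl′ (lopt m) refl ⟩
    Ro (A ⊕ h)  ≤⟨ Lo-⊕-≥ʳ {A = A} {X = X} (lopt m) ⟩
    Lo (A ⊕ X)  ∎

Rf-subadditive : (A : Game p) (X : Game q) → p ∧ q ≡ false → Rf (A ⊕ X) ≤ Rf A + Rf X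
Rf-subadditive = pairInd Sub step
  where
  Sub : {p q : Bool} → Game p → Game q → Set
  Sub {p} {q} A X = p ∧ q ≡ false → Rf (A ⊕ X) ≤ Rf A + Rf X

  even : {A X : Game false} → NotBothInt A X →
    (∀ {g} → LOpt g A → Sub g X) → (∀ {h} → LOpt h X → Sub A h) →
    Lo (A ⊕ X) ≤ Lo A + Lo X
  even {A} {X} nbi ihl ihl′ = Lo-⊕-lub nbi
    (λ {g} o → begin
      Ro (g ⊕ X)  ≤⟨ ihl o refl ⟩
      Ro g + Lo X ≤⟨ ℤ.+-monoˡ-≤ (Lo X) (Lo-≥ o) ⟩
      Lo A + Lo X ∎)
    (λ {h} o → begin
      Ro (A ⊕ h)  ≤⟨ ihl′ o refl ⟩
      Lo A + Ro h ≤⟨ ℤ.+-monoʳ-≤ (Lo A) (Lo-≥ o) ⟩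
      Lo A + Lo X ∎)

  step : PairStep Sub
  step {true} {true} _ _ _ _ _ _ ()
  step {false} {false} (int m) (int n) _ _ _ _ _ = ℤ.≤-refl
  step {false} {false} (node _ _) X ihl _ ihl′ _ _ = even nodeˡ ihl ihl′
  step {false} {false} A@(int _) (node _ _) ihl _ ihl′ _ _ = even {A = A} nodeʳ ihl ihl′
  step {true} {false} A@(node l r) X _ ihr _ _ _ = let (g , m , e) = minL-attained r in begin
    Ro (A ⊕ X)  ≤⟨ Ro-⊕-≤ˡ {A = A} (ropt m) ⟩
    Lo (g ⊕ X)  ≤⟨ ihr (ropt m) refl ⟩
    Lo g + Lo X ≡⟨ cong (_+ Lo X) e ⟩
    Ro A + Lo X ∎
  step {false} {true} A X@(node l r) _ _ _ ihr′ _ = let (h , m , e) = minL-attained r in begin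
    Ro (A ⊕ X)  ≤⟨ Ro-⊕-≤ʳ {A = A} {X = X} (ropt m) ⟩
    Lo (A ⊕ h)  ≤⟨ ihr′ (ropt m) refl ⟩
    Lo A + Lo h ≡⟨ cong (Lo A +_) e ⟩
    Lo A + Ro X ∎

ZugzwangFree⇒Lf-⊕-≤ : (A : Game p) (X : Game q) → p ∧ not q ≡ false →
  ZugzwangFree A → Lf (A ⊕ X) ≤ Rf A + Lf X
ZugzwangFree⇒Lf-⊕-≤ = pairInd Bound step
  where
  Bound : {p q : Bool} → Game p → Game q → Set
  Bound {p} {q} A X = p ∧ not q ≡ false → ZugzwangFree A → Lf (A ⊕ X) ≤ Rf A + Lf X

  step : PairStep Bound
  step {true} {false} _ _ _ _ _ _ ()
  step {false} {false} A (int n) _ _ _ _ _ free = begin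
    Ro (A ⊕ int n) ≡⟨ proj₂ (outcomes-⊕-int n A) ⟩
    Ro A + n       ≤⟨ ℤ.+-monoˡ-≤ n (free A self) ⟩
    Lo A + n       ∎
  step {false} {false} A X@(node l r) _ _ _ ihr′ _ free = let (h , m , e) = minL-attained r in begin
    Ro (A ⊕ X)  ≤⟨ Ro-⊕-≤ʳ {A = A} {X = X} (ropt m) ⟩
    Lo (A ⊕ h)  ≤⟨ ihr′ (ropt m) refl free ⟩
    Lo A + Lo h ≡⟨ cong (Lo A +_) e ⟩
    Lo A + Ro X ∎
  step {false} {true} A X@(node _ _) ihl _ ihl′ _ _ free = Lo-⊕-lub {A = A} nodeʳ
    (λ {g} o → begin
      Ro (g ⊕ X)  ≤⟨ ihl o refl (proj₁ (ZugzwangFree-options free) o) ⟩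
      Ro g + Lo X ≤⟨ ℤ.+-monoˡ-≤ (Lo X) (Lo-≥ o) ⟩
      Lo A + Lo X ∎)
    (λ {h} o → begin
      Ro (A ⊕ h)  ≤⟨ ihl′ o refl free ⟩
      Lo A + Ro h ≤⟨ ℤ.+-monoʳ-≤ (Lo A) (Lo-≥ o) ⟩
      Lo A + Lo X ∎)
  step {true} {true} A@(node l r) X _ ihr _ _ _ free = let (g , m , e) = minL-attained r in begin
    Ro (A ⊕ X)  ≤⟨ Ro-⊕-≤ˡ {A = A} (ropt m) ⟩
    Lo (g ⊕ X)  ≤⟨ ihr (ropt m) refl (proj₂ (ZugzwangFree-options free) (ropt m)) ⟩
    Lo g + Lo X ≡⟨ cong (_+ Lo X) e ⟩
    Ro A + Lo X ∎

ZugzwangFree⇒Rf-⊕-≥ : (A : Game p) (X : Game q) → p ∧ not q ≡ false →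
  ZugzwangFree A → Lf A + Rf X ≤ Rf (A ⊕ X)
ZugzwangFree⇒Rf-⊕-≥ = pairInd Bound step
  where
  Bound : {p q : Bool} → Game p → Game q → Set
  Bound {p} {q} A X = p ∧ not q ≡ false → ZugzwangFree A → Lf A + Rf X ≤ Rf (A ⊕ X)

  step : PairStep Bound
  step {true} {false} _ _ _ _ _ _ ()
  step {false} {false} A (int n) _ _ _ _ _ free = begin
    Ro A + n       ≤⟨ ℤ.+-monoˡ-≤ n (free A self) ⟩
    Lo A + n       ≡⟨ sym (proj₁ (outcomes-⊕-int n A)) ⟩
    Lo (A ⊕ int n) ∎
  step {false} {false} A X@(node l r) _ _ ihl′ _ _ free = let (h , m , e) = maxR-attained l in begin
    Ro A + Lo X ≡⟨ cong (Ro A +_) (sym e) ⟩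
    Ro A + Ro h ≤⟨ ihl′ (lopt m) refl free ⟩
    Ro (A ⊕ h)  ≤⟨ Lo-⊕-≥ʳ {A = A} {X = X} (lopt m) ⟩
    Lo (A ⊕ X)  ∎
  step {false} {true} A X@(node _ _) _ ihr _ ihr′ _ free = Ro-⊕-glb {A = A} nodeʳ
    (λ {g} o → begin
      Ro A + Ro X ≤⟨ ℤ.+-monoˡ-≤ (Ro X) (Ro-≤ o) ⟩
      Lo g + Ro X ≤⟨ ihr o refl (proj₂ (ZugzwangFree-options free) o) ⟩
      Lo (g ⊕ X)  ∎)
    (λ {h} o → begin
      Ro A + Ro X ≤⟨ ℤ.+-monoʳ-≤ (Ro A) (Ro-≤ o) ⟩
      Ro A + Lo h ≤⟨ ihr′ o refl free ⟩
      Lo (A ⊕ h)  ∎)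
  step {true} {true} A@(node l r) X ihl _ _ _ _ free = let (g , m , e) = maxR-attained l in begin
    Lo A + Ro X ≡⟨ cong (_+ Ro X) (sym e) ⟩
    Ro g + Ro X ≤⟨ ihl (lopt m) refl (proj₁ (ZugzwangFree-options free) (lopt m)) ⟩
    Ro (g ⊕ X)  ≤⟨ Lo-⊕-≥ˡ {A = A} (lopt m) ⟩
    Lo (A ⊕ X)  ∎

zugzwang-NotBothInt : {H : Game false} {X : Game q} → IsZugzwang H → NotBothInt H X
zugzwang-NotBothInt {H = int n} n<n = ⊥-elim (ℤ.<-irrefl refl n<n)
zugzwang-NotBothInt {H = node _ _} _ = nodeˡ

module _ {H : Game false} (free : OptionsZugzwangFree H) (zz : IsZugzwang H) where

  Lf-zugzwang : (X : Game q) → Lf (H ⊕ X) ≡ Ro H + Lf X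
  Lf-zugzwang X = ℤ.≤-antisym (gameInd Bound step X) (Lf-superadditive H X refl)
    where
    Bound : {q : Bool} → Game q → Set
    Bound X = Lf (H ⊕ X) ≤ Ro H + Lf X

    step : GameStep Bound
    step (int n) _ _ = ℤ.≤-reflexive (Lf-⊕-int n H)
    step {false} X@(node l r) _ ihr = let (h , m , e) = minL-attained r in begin
      Ro (H ⊕ X)  ≤⟨ Ro-⊕-≤ʳ {A = H} {X = X} (ropt m) ⟩
      Lo (H ⊕ h)  ≤⟨ ihr (ropt m) ⟩
      Ro H + Lo h ≡⟨ cong (Ro H +_) e ⟩
      Ro H + Ro X ∎
    step {true} X@(node _ _) ihl _ = Lo-⊕-lub (zugzwang-NotBothInt zz)
      (λ {g} o → begin
        Ro (g ⊕ X)  ≤⟨ ZugzwangFree⇒Lf-⊕-≤ g X refl (proj₁ free o) ⟩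
        Ro g + Lo X ≤⟨ ℤ.+-monoˡ-≤ (Lo X) (ℤ.<⇒≤ (ℤ.≤-<-trans (Lo-≥ o) zz)) ⟩
        Ro H + Lo X ∎)
      (λ {h} o → begin
        Ro (H ⊕ h)  ≤⟨ ihl o ⟩
        Ro H + Ro h ≤⟨ ℤ.+-monoʳ-≤ (Ro H) (Lo-≥ o) ⟩
        Ro H + Lo X ∎)

  Rf-zugzwang : (X : Game q) → Rf (H ⊕ X) ≡ Lo H + Rf X
  Rf-zugzwang X = ℤ.≤-antisym (Rf-subadditive H X refl) (gameInd Bound step X)
    where
    Bound : {q : Bool} → Game q → Set
    Bound X = Lo H + Rf X ≤ Rf (H ⊕ X)

    step : GameStep Bound
    step (int n) _ _ = ℤ.≤-reflexive (sym (Rf-⊕-int n H))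
    step {false} X@(node l r) ihl _ = let (h , m , e) = maxR-attained l in begin
      Lo H + Lo X ≡⟨ cong (Lo H +_) (sym e) ⟩
      Lo H + Ro h ≤⟨ ihl (lopt m) ⟩
      Ro (H ⊕ h)  ≤⟨ Lo-⊕-≥ʳ {A = H} {X = X} (lopt m) ⟩
      Lo (H ⊕ X)  ∎
    step {true} X@(node _ _) _ ihr = Ro-⊕-glb (zugzwang-NotBothInt zz)
      (λ {g} o → begin
        Lo H + Ro X ≤⟨ ℤ.+-monoˡ-≤ (Ro X) (ℤ.<⇒≤ (ℤ.<-≤-trans zz (Ro-≤ o))) ⟩
        Lo g + Ro X ≤⟨ ZugzwangFree⇒Rf-⊕-≥ g X refl (proj₂ free o) ⟩
        Lo (g ⊕ X)  ∎)
      (λ {h} o → begin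
        Lo H + Ro X ≤⟨ ℤ.+-monoʳ-≤ (Lo H) (Ro-≤ o) ⟩
        Lo H + Lo h ≤⟨ ihr o ⟩
        Lo (H ⊕ h)  ∎)

  int-Ro-≳-zugzwang : int (Ro H) ≳ H
  int-Ro-≳-zugzwang {false} X =
      (begin
        Lo (H ⊕ X)          ≤⟨ Rf-subadditive H X refl ⟩
        Lo H + Lo X         ≤⟨ ℤ.+-monoˡ-≤ (Lo X) (ℤ.<⇒≤ zz) ⟩
        Ro H + Lo X         ≡⟨ sym (proj₁ (outcomes-int-⊕ (Ro H) X)) ⟩
        Lo (int (Ro H) ⊕ X) ∎)
    , ℤ.≤-reflexive (trans (Lf-zugzwang X) (sym (proj₂ (outcomes-int-⊕ (Ro H) X))))
  int-Ro-≳-zugzwang {true} X =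
      ℤ.≤-reflexive (trans (Lf-zugzwang X) (sym (proj₁ (outcomes-int-⊕ (Ro H) X))))
    , (begin
        Ro (H ⊕ X)          ≤⟨ Rf-subadditive H X refl ⟩
        Lo H + Ro X         ≤⟨ ℤ.+-monoˡ-≤ (Ro X) (ℤ.<⇒≤ zz) ⟩
        Ro H + Ro X         ≡⟨ sym (proj₂ (outcomes-int-⊕ (Ro H) X)) ⟩
        Ro (int (Ro H) ⊕ X) ∎)

  zugzwang-≳-int-Lo : H ≳ int (Lo H)
  zugzwang-≳-int-Lo {false} X =
      ℤ.≤-reflexive (trans (proj₁ (outcomes-int-⊕ (Lo H) X)) (sym (Rf-zugzwang X)))
    , (begin
        Ro (int (Lo H) ⊕ X) ≡⟨ proj₂ (outcomes-int-⊕ (Lo H) X) ⟩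
        Lo H + Ro X         ≤⟨ ℤ.+-monoˡ-≤ (Ro X) (ℤ.<⇒≤ zz) ⟩
        Ro H + Ro X         ≤⟨ Lf-superadditive H X refl ⟩
        Ro (H ⊕ X)          ∎)
  zugzwang-≳-int-Lo {true} X =
      (begin
        Lo (int (Lo H) ⊕ X) ≡⟨ proj₁ (outcomes-int-⊕ (Lo H) X) ⟩
        Lo H + Lo X         ≤⟨ ℤ.+-monoˡ-≤ (Lo X) (ℤ.<⇒≤ zz) ⟩
        Ro H + Lo X         ≤⟨ Lf-superadditive H X refl ⟩
        Lo (H ⊕ X)          ∎)
    , ℤ.≤-reflexive (trans (proj₂ (outcomes-int-⊕ (Lo H) X)) (sym (Rf-zugzwang X)))

record Correspond {p : Bool} (_~_ : Game p → Game p → Set) (os′ os : Opts p) : Set where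
  field
    forth : ∀ {g′} → g′ ∈ᴼ os′ → Σ[ g ∈ Game p ] g ∈ᴼ os × g′ ~ g
    back  : ∀ {g} → g ∈ᴼ os → Σ[ g′ ∈ Game p ] g′ ∈ᴼ os′ × g′ ~ g

open Correspond

Correspond-map : {_~_ _≈_ : Game p → Game p → Set} {os′ os : Opts p} →
  (∀ {g′ g} → g′ ~ g → g′ ≈ g) → Correspond _~_ os′ os → Correspond _≈_ os′ os
Correspond-map f c .forth m = let (g , m′ , rel) = c .forth m in g , m′ , f rel
Correspond-map f c .back m = let (g′ , m′ , rel) = c .back m in g′ , m′ , f rel

Correspond-flip : {_~_ : Game p → Game p → Set} {os′ os : Opts p} →
  Correspond _~_ os′ os → Correspond (flip _~_) os os′
Correspond-flip c .forth = c .back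
Correspond-flip c .back = c .forth

Lo-⊕-mono : {l r l′ r′ : Opts (not p)} {X : Game q} →
  Correspond (λ g′ g → Ro (g ⊕ X) ≤ Ro (g′ ⊕ X)) l′ l →
  (∀ {h} → LOpt h X → Ro (node l r ⊕ h) ≤ Ro (node l′ r′ ⊕ h)) →
  Lo (node l r ⊕ X) ≤ Lo (node l′ r′ ⊕ X)
Lo-⊕-mono {l′ = l′} {r′} cl ih = Lo-⊕-lub nodeˡ
  (λ { (lopt m) → let (g′ , m′ , le) = cl .back m in
                   ℤ.≤-trans le (Lo-⊕-≥ˡ {A = node l′ r′} (lopt m′)) })
  (λ o → ℤ.≤-trans (ih o) (Lo-⊕-≥ʳ {A = node l′ r′} o))

Ro-⊕-mono : {l r l′ r′ : Opts (not p)} {X : Game q} →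
  Correspond (λ g′ g → Lo (g ⊕ X) ≤ Lo (g′ ⊕ X)) r′ r →
  (∀ {h} → ROpt h X → Lo (node l r ⊕ h) ≤ Lo (node l′ r′ ⊕ h)) →
  Ro (node l r ⊕ X) ≤ Ro (node l′ r′ ⊕ X)
Ro-⊕-mono {l = l} {r} cr ih = Ro-⊕-glb nodeˡ
  (λ { (ropt m) → let (g , m′ , le) = cr .forth m in
                   ℤ.≤-trans (Ro-⊕-≤ˡ {A = node l r} (ropt m′)) le })
  (λ o → ℤ.≤-trans (Ro-⊕-≤ʳ {A = node l r} o) (ih o))

≳-node : {l r l′ r′ : Opts (not p)} →
  Correspond _≳_ l′ l → Correspond _≳_ r′ r → node l′ r′ ≳ node l r
≳-node {l = l} {r} {l′} {r′} cl cr = gameInd Mono step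
  where
  Mono : {q : Bool} → Game q → Set
  Mono X = Lo (node l r ⊕ X) ≤ Lo (node l′ r′ ⊕ X)
         × Ro (node l r ⊕ X) ≤ Ro (node l′ r′ ⊕ X)

  step : GameStep Mono
  step X ihl ihr =
      Lo-⊕-mono (Correspond-map (λ ge → proj₂ (ge X)) cl) (λ o → proj₂ (ihl o))
    , Ro-⊕-mono (Correspond-map (λ ge → proj₁ (ge X)) cr) (λ o → proj₁ (ihr o))

_≳ᴸ_ : {p q : Bool} → Game p → Game q → Set
G ≳ᴸ H = ∀ {r} (X : Game r) → Lf (H ⊕ X) ≤ Lf (G ⊕ X)

_≳ᴿ_ : {p q : Bool} → Game p → Game q → Set
G ≳ᴿ H = ∀ {r} (X : Game r) → Rf (H ⊕ X) ≤ Rf (G ⊕ X)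

≳ᴸ-node : {l r l′ r′ : Opts (not p)} →
  Correspond _≳ᴸ_ l′ l → Correspond _≳ᴸ_ r′ r → node l′ r′ ≳ᴸ node l r
≳ᴸ-node cl cr = gameInd _ (step cl cr)
  where
  step : {l r l′ r′ : Opts (not p)} → Correspond _≳ᴸ_ l′ l → Correspond _≳ᴸ_ r′ r →
    GameStep (λ X → Lf (node l r ⊕ X) ≤ Lf (node l′ r′ ⊕ X))
  step {true} cl _ {false} X ihl _ = Lo-⊕-mono (Correspond-map (λ ge → ge X) cl) ihl
  step {false} cl _ {true} X ihl _ = Lo-⊕-mono (Correspond-map (λ ge → ge X) cl) ihl
  step {true} _ cr {true} X _ ihr = Ro-⊕-mono (Correspond-map (λ ge → ge X) cr) ihr
  step {false} _ cr {false} X _ ihr = Ro-⊕-mono (Correspond-map (λ ge → ge X) cr) ihr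

≳ᴿ-node : {l r l′ r′ : Opts (not p)} →
  Correspond _≳ᴿ_ l′ l → Correspond _≳ᴿ_ r′ r → node l′ r′ ≳ᴿ node l r
≳ᴿ-node cl cr = gameInd _ (step cl cr)
  where
  step : {l r l′ r′ : Opts (not p)} → Correspond _≳ᴿ_ l′ l → Correspond _≳ᴿ_ r′ r →
    GameStep (λ X → Rf (node l r ⊕ X) ≤ Rf (node l′ r′ ⊕ X))
  step {true} cl _ {true} X ihl _ = Lo-⊕-mono (Correspond-map (λ ge → ge X) cl) ihl
  step {false} cl _ {false} X ihl _ = Lo-⊕-mono (Correspond-map (λ ge → ge X) cl) ihl
  step {true} _ cr {false} X _ ihr = Ro-⊕-mono (Correspond-map (λ ge → ge X) cr) ihr
  step {false} _ cr {true} X _ ihr = Ro-⊕-mono (Correspond-map (λ ge → ge X) cr) ihr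

≈₊-node : {l r l′ r′ : Opts (not p)} →
  Correspond _≈₊_ l′ l → Correspond _≈₊_ r′ r → node l′ r′ ≈₊ node l r
≈₊-node cl cr = refl , λ X → ℤ.≤-antisym
  (≳ᴸ-node (Correspond-map ≈₊⇒≲ᴸ (Correspond-flip cl))
             (Correspond-map ≈₊⇒≲ᴸ (Correspond-flip cr)) X)
  (≳ᴸ-node (Correspond-map ≈₊⇒≳ᴸ cl) (Correspond-map ≈₊⇒≳ᴸ cr) X)
  where
  ≈₊⇒≳ᴸ : {p : Bool} {G H : Game p} → G ≈₊ H → G ≳ᴸ H
  ≈₊⇒≳ᴸ (_ , e) X = ℤ.≤-reflexive (sym (e X))
  ≈₊⇒≲ᴸ : {p : Bool} {G H : Game p} → G ≈₊ H → H ≳ᴸ G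
  ≈₊⇒≲ᴸ (_ , e) X = ℤ.≤-reflexive (e X)

≈₋-node : {l r l′ r′ : Opts (not p)} →
  Correspond _≈₋_ l′ l → Correspond _≈₋_ r′ r → node l′ r′ ≈₋ node l r
≈₋-node cl cr = refl , λ X → ℤ.≤-antisym
  (≳ᴿ-node (Correspond-map ≈₋⇒≲ᴿ (Correspond-flip cl))
             (Correspond-map ≈₋⇒≲ᴿ (Correspond-flip cr)) X)
  (≳ᴿ-node (Correspond-map ≈₋⇒≳ᴿ cl) (Correspond-map ≈₋⇒≳ᴿ cr) X)
  where
  ≈₋⇒≳ᴿ : {p : Bool} {G H : Game p} → G ≈₋ H → G ≳ᴿ H
  ≈₋⇒≳ᴿ (_ , e) X = ℤ.≤-reflexive (sym (e X))
  ≈₋⇒≲ᴿ : {p : Bool} {G H : Game p} → G ≈₋ H → H ≳ᴿ G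
  ≈₋⇒≲ᴿ (_ , e) X = ℤ.≤-reflexive (e X)

≳-refl : {G : Game p} → G ≳ G
≳-refl X = ℤ.≤-refl , ℤ.≤-refl

≳-trans : {A : Game p} {B : Game q} {r : Bool} {C : Game r} → A ≳ B → B ≳ C → A ≳ C
≳-trans ab bc X =
  ℤ.≤-trans (proj₁ (bc X)) (proj₁ (ab X)) , ℤ.≤-trans (proj₂ (bc X)) (proj₂ (ab X))

IntsWithin : Game p → Game q → Set
IntsWithin G H = (n : ℤ) → Subgame (int n) G → Subgame (int n) H

IntsWithin-node : {l r l′ r′ : Opts (not p)} →
  Correspond IntsWithin l′ l → Correspond IntsWithin r′ r →
  IntsWithin (node l′ r′) (node l r)
IntsWithin-node cl _ n (viaL m sk) = let (_ , m′ , within) = cl .forth m in viaL m′ (within n sk)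
IntsWithin-node _ cr n (viaR m sk) = let (_ , m′ , within) = cr .forth m in viaR m′ (within n sk)

module Collapse (value : Game false → ℤ)
  (value-realized : (H : Game false) → Subgame (int (value H)) H) where

  collapse : (H : Game false) → Dec (IsZugzwang H) → Game false
  collapse H (yes _) = int (value H)
  collapse H (no _) = H

  tidy : Game p → Game p
  tidy {false} H = collapse H (Lo H ℤ.<? Ro H)
  tidy {true} H = H

  mutual
    rebuild : Game p → Game p
    rebuild (int n) = int n
    rebuild (node l r) = tidy (node (rebuildᴼ l) (rebuildᴼ r))

    rebuildᴼ : Opts p → Opts p
    rebuildᴼ [ g ] = [ rebuild g ]
    rebuildᴼ (g ∷ os) = rebuild g ∷ rebuildᴼ os

  ∈-rebuildᴼ⁺ : {os : Opts p} {g : Game p} → g ∈ᴼ os → rebuild g ∈ᴼ rebuildᴼ os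
  ∈-rebuildᴼ⁺ here₁ = here₁
  ∈-rebuildᴼ⁺ here = here
  ∈-rebuildᴼ⁺ (there m) = there (∈-rebuildᴼ⁺ m)

  ∈-rebuildᴼ⁻ : (os : Opts p) {x : Game p} → x ∈ᴼ rebuildᴼ os →
    Σ[ g ∈ Game p ] g ∈ᴼ os × x ≡ rebuild g
  ∈-rebuildᴼ⁻ [ g ] here₁ = g , here₁ , refl
  ∈-rebuildᴼ⁻ (g ∷ os) here = g , here , refl
  ∈-rebuildᴼ⁻ (g ∷ os) (there m) = let (g′ , m′ , e) = ∈-rebuildᴼ⁻ os m in
    g′ , there m′ , e

  rebuildᴼ-all : {P : Game p → Set} (os : Opts p) → (∀ {g} → g ∈ᴼ os → P (rebuild g)) →
    ∀ {x} → x ∈ᴼ rebuildᴼ os → P x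
  rebuildᴼ-all {P = P} os all m = let (g , m′ , e) = ∈-rebuildᴼ⁻ os m in
    subst P (sym e) (all m′)

  rebuildᴼ-Correspond : {_~_ : Game p → Game p → Set} (os : Opts p) →
    (∀ {g} → g ∈ᴼ os → rebuild g ~ g) → Correspond _~_ (rebuildᴼ os) os
  rebuildᴼ-Correspond {_~_ = _~_} os rel .forth m =
    let (g , m′ , e) = ∈-rebuildᴼ⁻ os m in g , m′ , subst (_~ g) (sym e) (rel m′)
  rebuildᴼ-Correspond os rel .back m = _ , ∈-rebuildᴼ⁺ m , rel m

  rebuilt-options-free : {l r : Opts (not p)} →
    (∀ {g} → LOpt g (node l r) → ZugzwangFree (rebuild g)) →
    (∀ {g} → ROpt g (node l r) → ZugzwangFree (rebuild g)) →
    OptionsZugzwangFree (node {p} (rebuildᴼ l) (rebuildᴼ r))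
  rebuilt-options-free {l = l} {r} freeˡ freeʳ =
      (λ { (lopt m) → rebuildᴼ-all {P = ZugzwangFree} l (λ m′ → freeˡ (lopt m′)) m })
    , (λ { (ropt m) → rebuildᴼ-all {P = ZugzwangFree} r (λ m′ → freeʳ (ropt m′)) m })

  collapse-free : {H : Game false} → OptionsZugzwangFree H → (d : Dec (IsZugzwang H)) →
    ZugzwangFree (collapse H d)
  collapse-free _ (yes _) = ZugzwangFree-int _
  collapse-free {H = int n} _ (no _) = ZugzwangFree-int n
  collapse-free {H = node _ _} free (no ¬zz) = ZugzwangFree-node (λ _ → ℤ.≮⇒≥ ¬zz) free

  tidy-free : (H : Game p) → OptionsZugzwangFree H → ZugzwangFree (tidy H)
  tidy-free {false} H free = collapse-free free _
  tidy-free {true} (node _ _) free = ZugzwangFree-node (λ ()) free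

  rebuild-free : (G : Game p) → ZugzwangFree (rebuild G)
  rebuild-free = gameInd (λ G → ZugzwangFree (rebuild G)) step
    where
    step : GameStep (λ G → ZugzwangFree (rebuild G))
    step (int n) _ _ = ZugzwangFree-int n
    step (node l r) ihl ihr = tidy-free _ (rebuilt-options-free ihl ihr)

  module _ (_~_ : {p : Bool} → Game p → Game p → Set)
    (~-refl : {p : Bool} {G : Game p} → G ~ G)
    (~-trans : {p : Bool} {A B C : Game p} → A ~ B → B ~ C → A ~ C)
    (~-node : {p : Bool} {l r l′ r′ : Opts (not p)} →
      Correspond _~_ l′ l → Correspond _~_ r′ r → node l′ r′ ~ node l r)
    (~-zugzwang : {H : Game false} → OptionsZugzwangFree H → IsZugzwang H → int (value H) ~ H)
    where

    collapse-related : {H : Game false} → OptionsZugzwangFree H → (d : Dec (IsZugzwang H)) →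
      collapse H d ~ H
    collapse-related free (yes zz) = ~-zugzwang free zz
    collapse-related _ (no _) = ~-refl

    tidy-related : (H : Game p) → OptionsZugzwangFree H → tidy H ~ H
    tidy-related {false} H free = collapse-related free _
    tidy-related {true} H _ = ~-refl

    rebuild-related : (G : Game p) → rebuild G ~ G
    rebuild-related = gameInd (λ G → rebuild G ~ G) step
      where
      step : GameStep (λ G → rebuild G ~ G)
      step (int n) _ _ = ~-refl
      step (node l r) ihl ihr = ~-trans
        (tidy-related _ (rebuilt-options-free (λ {g} _ → rebuild-free g) (λ {g} _ → rebuild-free g)))
        (~-node (rebuildᴼ-Correspond l (λ m → ihl (lopt m)))
                (rebuildᴼ-Correspond r (λ m → ihr (ropt m))))

  rebuild-ints : (G : Game p) → IntsWithin (rebuild G) G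
  rebuild-ints = rebuild-related IntsWithin
    (λ _ sk → sk) (λ ab bc n sk → bc n (ab n sk)) IntsWithin-node
    (λ {H} _ _ → λ { n self → value-realized H })

module Plus = Collapse Ro (λ H → proj₂ (outcomes-realized H))
module Minus = Collapse Lo (λ H → proj₁ (outcomes-realized H))

infix 30 _⁺ _⁻

_⁺ : Game p → Game p
_⁺ = Plus.rebuild

_⁻ : Game p → Game p
_⁻ = Minus.rebuild

⁺-≈₊ : (G : Game p) → G ⁺ ≈₊ G
⁺-≈₊ = Plus.rebuild-related _≈₊_
  (refl , λ _ → refl) (λ a b → refl , λ X → trans (proj₂ a X) (proj₂ b X)) ≈₊-node
  (λ {H} free zz → refl , λ X → trans (Lf-int-⊕ (Ro H) X) (sym (Lf-zugzwang free zz X)))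

⁻-≈₋ : (G : Game p) → G ≈₋ G ⁻
⁻-≈₋ = Minus.rebuild-related (flip _≈₋_)
  (refl , λ _ → refl) (λ a b → refl , λ X → trans (proj₂ b X) (proj₂ a X))
  (λ cl cr → ≈₋-node (Correspond-flip cl) (Correspond-flip cr))
  (λ {H} free zz → refl , λ X → trans (Rf-zugzwang free zz X) (sym (Rf-int-⊕ (Lo H) X)))

⁺-≳ : (G : Game p) → G ⁺ ≳ G
⁺-≳ = Plus.rebuild-related _≳_ (λ {_} {G} → ≳-refl {G = G})
  (λ {_} {A} {B} {C} → ≳-trans {A = A} {B = B} {C = C}) ≳-node int-Ro-≳-zugzwang

≳-⁻ : (G : Game p) → G ≳ G ⁻
≳-⁻ = Minus.rebuild-related (flip _≳_) (λ {_} {G} → ≳-refl {G = G})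
  (λ {_} {A} {B} {C} ab bc → ≳-trans {A = C} {B = B} {C = A} bc ab)
  (λ cl cr → ≳-node (Correspond-flip cl) (Correspond-flip cr)) zugzwang-≳-int-Lo

mainTheorem8 : {p : Bool} (G : Game p) (S : ℤ → Set) → SValued S G →
    Σ (Game p) (λ G⁺ → Σ (Game p) (λ G⁻ →
    𝓘 G⁺ × 𝓘 G⁻ × (G⁺ ≈₊ G) × (G ≈₋ G⁻) ×
    SValued S G⁺ × SValued S G⁻ × (G⁺ ≳ G⁻)))
mainTheorem8 G S sv =
    G ⁺ , G ⁻
  , ZugzwangFree⇒𝓘 (G ⁺) (Plus.rebuild-free G)
  , ZugzwangFree⇒𝓘 (G ⁻) (Minus.rebuild-free G)
  , ⁺-≈₊ G
  , ⁻-≈₋ G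
  , (λ n sk → sv n (Plus.rebuild-ints G n sk))
  , (λ n sk → sv n (Minus.rebuild-ints G n sk))
  , ≳-trans {A = G ⁺} {B = G} {C = G ⁻} (⁺-≳ G) (≳-⁻ G)
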